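{- In a category $\mathcal{C}$ with cofibrations and an interval satisfying the general conditions (G1)–(G7) below, if $f\colon X\to Y$ is an hproposition and has a section, then $f$ is a trivial fibration.
   Context: $\mathcal{C}$ is locally cartesian closed with finite colimits, with cofibrations and an interval $\delta_0,\delta_1\colon1\to\mathbb{I}$. Trivial fibrations: maps with the right lifting property (RLP) against all cofibrations. Fibrations: maps with the RLP against $\delta_0\hat\times m$, $\delta_1\hat\times m$ for all cofibrations $m$ ($\hat\times$ the pushout product). For $f\colon X\to Y$, $P_Y(X)$ is the pullback of $f^{\mathbb{I}}\colon X^{\mathbb{I}}\to Y^{\mathbb{I}}$ along the constant-path map $r^Y\colon Y\to Y^{\mathbb{I}}$, with induced maps $p_0^f,p_1^f\colon P_Y(X)\to X$ (evaluation at endpoints); $f$ is an hproposition if it is a fibration and $\langle p_0^f,p_1^f\rangle\colon P_Y(X)\to X\times_YX$ is a trivial fibration. (G1) cofibrations are closed under pullback; (G2) cofibrations are closed under binary unions; (G3) $\mathbb{I}$ has connections $\wedge,\vee$ with $0\wedge i=i\wedge0=0$, $1\wedge i=i\wedge1=i$, $0\vee i=i\vee0=i$, $1\vee i=i\vee1=1$; (G4) $\delta_0,\delta_1$ are disjoint; (G5) $\delta_0,\delta_1$ are cofibrations; (G6) every map factors as a cofibration followed by a trivial fibration; (G7) every $0\to X$ is a cofibration. -}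

module Defs where

open import Level using (Level; _⊔_) renaming (suc to lsuc)
open import Relation.Binary using (IsEquivalence; Setoid)
open import Data.Product using (Σ; _×_; _,_; Σ-syntax)
import Relation.Binary.Reasoning.Setoid as SetoidReasoning

record Category (o ℓ e : Level) : Set (lsuc (o ⊔ ℓ ⊔ e)) where
  infix  4 _≈_
  infixr 9 _∘_
  infixr 5 _⇒_
  field
    Obj       : Set o
    _⇒_       : Obj → Obj → Set ℓ
    _≈_       : ∀ {A B} → A ⇒ B → A ⇒ B → Set e
    id        : ∀ {A} → A ⇒ A
    _∘_       : ∀ {A B C} → B ⇒ C → A ⇒ B → A ⇒ C
    ≈-equiv   : ∀ {A B} → IsEquivalence (_≈_ {A} {B})
    assoc     : ∀ {A B C D} {f : A ⇒ B} {g : B ⇒ C} {h : C ⇒ D} →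
                (h ∘ g) ∘ f ≈ h ∘ (g ∘ f)
    identityˡ : ∀ {A B} {f : A ⇒ B} → id ∘ f ≈ f
    identityʳ : ∀ {A B} {f : A ⇒ B} → f ∘ id ≈ f
    ∘-resp-≈  : ∀ {A B C} {f h : B ⇒ C} {g i : A ⇒ B} →
                f ≈ h → g ≈ i → f ∘ g ≈ h ∘ i

  hom-setoid : Obj → Obj → Setoid ℓ e
  hom-setoid A B = record { Carrier = A ⇒ B ; _≈_ = _≈_ ; isEquivalence = ≈-equiv }

  module _ {A B : Obj} where
    open IsEquivalence (≈-equiv {A} {B}) public
      renaming (refl to ≈-refl; sym to ≈-sym; trans to ≈-trans)

  module HomReasoning {A B : Obj} = SetoidReasoning (hom-setoid A B)

module Universal {o ℓ e : Level} (𝒞 : Category o ℓ e) where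
  open Category 𝒞

  record Terminal : Set (o ⊔ ℓ ⊔ e) where
    field
      ⊤        : Obj
      !        : ∀ {A} → A ⇒ ⊤
      !-unique : ∀ {A} (f : A ⇒ ⊤) → f ≈ !

  record IsInitial (Z : Obj) : Set (o ⊔ ℓ ⊔ e) where
    field
      ¡        : ∀ {A} → Z ⇒ A
      ¡-unique : ∀ {A} (f : Z ⇒ A) → f ≈ ¡

  record Initial : Set (o ⊔ ℓ ⊔ e) where
    field
      ⊥         : Obj
      isInitial : IsInitial ⊥
    open IsInitial isInitial public

  record Product (A B : Obj) : Set (o ⊔ ℓ ⊔ e) where
    field
      A×B      : Obj
      π₁       : A×B ⇒ A
      π₂       : A×B ⇒ B
      ⟨_,_⟩    : ∀ {Z} → Z ⇒ A → Z ⇒ B → Z ⇒ A×B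
      project₁ : ∀ {Z} {f : Z ⇒ A} {g : Z ⇒ B} → π₁ ∘ ⟨ f , g ⟩ ≈ f
      project₂ : ∀ {Z} {f : Z ⇒ A} {g : Z ⇒ B} → π₂ ∘ ⟨ f , g ⟩ ≈ g
      unique   : ∀ {Z} {f : Z ⇒ A} {g : Z ⇒ B} {h : Z ⇒ A×B} →
                 π₁ ∘ h ≈ f → π₂ ∘ h ≈ g → h ≈ ⟨ f , g ⟩

  record IsPullback {A B C P : Obj} (f : A ⇒ C) (g : B ⇒ C)
                    (p₁ : P ⇒ A) (p₂ : P ⇒ B) : Set (o ⊔ ℓ ⊔ e) where
    field
      commute   : f ∘ p₁ ≈ g ∘ p₂
      universal : ∀ {Z} {h₁ : Z ⇒ A} {h₂ : Z ⇒ B} → f ∘ h₁ ≈ g ∘ h₂ → Z ⇒ P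
      p₁∘universal : ∀ {Z} {h₁ : Z ⇒ A} {h₂ : Z ⇒ B} (eq : f ∘ h₁ ≈ g ∘ h₂) →
                     p₁ ∘ universal eq ≈ h₁
      p₂∘universal : ∀ {Z} {h₁ : Z ⇒ A} {h₂ : Z ⇒ B} (eq : f ∘ h₁ ≈ g ∘ h₂) →
                     p₂ ∘ universal eq ≈ h₂
      unique    : ∀ {Z} {h₁ : Z ⇒ A} {h₂ : Z ⇒ B} (eq : f ∘ h₁ ≈ g ∘ h₂)
                  {u : Z ⇒ P} → p₁ ∘ u ≈ h₁ → p₂ ∘ u ≈ h₂ → u ≈ universal eq

  record Pullback {A B C : Obj} (f : A ⇒ C) (g : B ⇒ C) : Set (o ⊔ ℓ ⊔ e) where
    field
      P          : Obj
      p₁         : P ⇒ A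
      p₂         : P ⇒ B
      isPullback : IsPullback f g p₁ p₂
    open IsPullback isPullback public

  record Pushout {A B C : Obj} (f : C ⇒ A) (g : C ⇒ B) : Set (o ⊔ ℓ ⊔ e) where
    field
      Q         : Obj
      i₁        : A ⇒ Q
      i₂        : B ⇒ Q
      commute   : i₁ ∘ f ≈ i₂ ∘ g
      copair    : ∀ {Z} {h₁ : A ⇒ Z} {h₂ : B ⇒ Z} → h₁ ∘ f ≈ h₂ ∘ g → Q ⇒ Z
      copair∘i₁ : ∀ {Z} {h₁ : A ⇒ Z} {h₂ : B ⇒ Z} (eq : h₁ ∘ f ≈ h₂ ∘ g) →
                  copair eq ∘ i₁ ≈ h₁
      copair∘i₂ : ∀ {Z} {h₁ : A ⇒ Z} {h₂ : B ⇒ Z} (eq : h₁ ∘ f ≈ h₂ ∘ g) →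
                  copair eq ∘ i₂ ≈ h₂
      unique    : ∀ {Z} {h₁ : A ⇒ Z} {h₂ : B ⇒ Z} (eq : h₁ ∘ f ≈ h₂ ∘ g)
                  {u : Q ⇒ Z} → u ∘ i₁ ≈ h₁ → u ∘ i₂ ≈ h₂ → u ≈ copair eq

  record FinitelyComplete : Set (o ⊔ ℓ ⊔ e) where
    field
      terminal : Terminal
      product  : ∀ A B → Product A B
      pullback : ∀ {A B C} (f : A ⇒ C) (g : B ⇒ C) → Pullback f g

  record FinitelyCocomplete : Set (o ⊔ ℓ ⊔ e) where
    field
      initial : Initial
      pushout : ∀ {A B C} (f : C ⇒ A) (g : C ⇒ B) → Pushout f g

module WithLimits {o ℓ e : Level} {𝒞 : Category o ℓ e}
                  (L : Universal.FinitelyComplete 𝒞) where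
  open Category 𝒞
  open Universal 𝒞
  open FinitelyComplete L
  open Terminal terminal public using (⊤; !; !-unique)

  infixr 7 _×₀_
  infixr 8 _⁂_

  _×₀_ : Obj → Obj → Obj
  A ×₀ B = Product.A×B (product A B)

  π₁ : ∀ {A B} → A ×₀ B ⇒ A
  π₁ {A} {B} = Product.π₁ (product A B)

  π₂ : ∀ {A B} → A ×₀ B ⇒ B
  π₂ {A} {B} = Product.π₂ (product A B)

  ⟨_,_⟩ : ∀ {Z A B} → Z ⇒ A → Z ⇒ B → Z ⇒ A ×₀ B
  ⟨_,_⟩ {A = A} {B} = Product.⟨_,_⟩ (product A B)

  _⁂_ : ∀ {A B C D} → A ⇒ B → C ⇒ D → A ×₀ C ⇒ B ×₀ D
  f ⁂ g = ⟨ f ∘ π₁ , g ∘ π₂ ⟩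

  record Exponential (A B : Obj) : Set (o ⊔ ℓ ⊔ e) where
    field
      A⇨B      : Obj
      eval     : A⇨B ×₀ A ⇒ B
      curry    : ∀ {Z} → Z ×₀ A ⇒ B → Z ⇒ A⇨B
      β        : ∀ {Z} {g : Z ×₀ A ⇒ B} → eval ∘ (curry g ⁂ id) ≈ g
      λ-unique : ∀ {Z} {g : Z ×₀ A ⇒ B} {h : Z ⇒ A⇨B} →
                 eval ∘ (h ⁂ id) ≈ g → h ≈ curry g

  induced : ∀ {A B Π Z} (f : A ⇒ B) (q : Π ⇒ B) {r : Z ⇒ B} (h : Z ⇒ Π) →
            q ∘ h ≈ r →
            Pullback.P (pullback f r) ⇒ Pullback.P (pullback f q)
  induced f q {r} h eq =
    Pullback.universal (pullback f q) {h₁ = Pullback.p₁ (pullback f r)}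
      {h₂ = h ∘ Pullback.p₂ (pullback f r)}
      (begin
        f ∘ Pullback.p₁ (pullback f r)  ≈⟨ Pullback.commute (pullback f r) ⟩
        r ∘ Pullback.p₂ (pullback f r)  ≈⟨ ∘-resp-≈ (≈-sym eq) ≈-refl ⟩
        (q ∘ h) ∘ Pullback.p₂ (pullback f r) ≈⟨ assoc ⟩
        q ∘ (h ∘ Pullback.p₂ (pullback f r)) ∎)
    where open HomReasoning

  -- dependent product  Π_f(p)  of  p : E ⇒ A  along  f : A ⇒ B
  -- (right adjoint to pullback f* : 𝒞/B → 𝒞/A, given by its universal property)
  record DependentProduct {A B E : Obj} (f : A ⇒ B) (p : E ⇒ A)
         : Set (o ⊔ ℓ ⊔ e) where
    field
      Π        : Obj
      q        : Π ⇒ B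
      ev       : Pullback.P (pullback f q) ⇒ E
      ev-over  : p ∘ ev ≈ Pullback.p₁ (pullback f q)
      lam      : ∀ {Z} (r : Z ⇒ B) (g : Pullback.P (pullback f r) ⇒ E) →
                 p ∘ g ≈ Pullback.p₁ (pullback f r) → Z ⇒ Π
      lam-over : ∀ {Z} (r : Z ⇒ B) (g : Pullback.P (pullback f r) ⇒ E)
                 (eq : p ∘ g ≈ Pullback.p₁ (pullback f r)) →
                 q ∘ lam r g eq ≈ r
      lam-β    : ∀ {Z} (r : Z ⇒ B) (g : Pullback.P (pullback f r) ⇒ E)
                 (eq : p ∘ g ≈ Pullback.p₁ (pullback f r)) →
                 ev ∘ induced f q (lam r g eq) (lam-over r g eq) ≈ g
      lam-unique : ∀ {Z} (r : Z ⇒ B) (g : Pullback.P (pullback f r) ⇒ E)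
                   (eq : p ∘ g ≈ Pullback.p₁ (pullback f r))
                   (h : Z ⇒ Π) (hq : q ∘ h ≈ r) →
                   ev ∘ induced f q h hq ≈ g → h ≈ lam r g eq

-- A locally cartesian closed category with finite colimits
-- (exponentials are included explicitly; they also follow from Π along A ⇒ ⊤)
record LCCCWithFiniteColimits {o ℓ e : Level} (𝒞 : Category o ℓ e)
       : Set (o ⊔ ℓ ⊔ e) where
  open Category 𝒞
  field
    finLim    : Universal.FinitelyComplete 𝒞
    finColim  : Universal.FinitelyCocomplete 𝒞
    exponential : ∀ A B → WithLimits.Exponential finLim A B
    dependentProduct : ∀ {A B E} (f : A ⇒ B) (p : E ⇒ A) →
                       WithLimits.DependentProduct finLim f p

module Homotopy {o ℓ e : Level} {𝒞 : Category o ℓ e}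
                (𝓛 : LCCCWithFiniteColimits 𝒞) where
  open Category 𝒞
  open Universal 𝒞
  open LCCCWithFiniteColimits 𝓛
  open WithLimits finLim public
  open FinitelyComplete finLim public using (pullback)
  open FinitelyCocomplete finColim public using (initial; pushout)
  open Initial initial public using (⊥; ¡)

  _⇨_ : Obj → Obj → Obj
  A ⇨ B = Exponential.A⇨B (exponential A B)

  eval : ∀ {A B} → (A ⇨ B) ×₀ A ⇒ B
  eval {A} {B} = Exponential.eval (exponential A B)

  curry : ∀ {Z A B} → Z ×₀ A ⇒ B → Z ⇒ A ⇨ B
  curry {A = A} {B} = Exponential.curry (exponential A B)

  HasRLP : ∀ {A B X Y} (m : A ⇒ B) (f : X ⇒ Y) → Set (ℓ ⊔ e)
  HasRLP {A} {B} {X} {Y} m f =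
    ∀ (u : A ⇒ X) (v : B ⇒ Y) → f ∘ u ≈ v ∘ m →
    Σ[ d ∈ B ⇒ X ] ((d ∘ m ≈ u) × (f ∘ d ≈ v))

  ⟨⟩∘ : ∀ {W Z A B} {f : Z ⇒ A} {g : Z ⇒ B} {h : W ⇒ Z} →
        ⟨ f , g ⟩ ∘ h ≈ ⟨ f ∘ h , g ∘ h ⟩
  ⟨⟩∘ {A = A} {B} {f} {g} {h} = Product.unique (product A B)
    (begin π₁ ∘ (⟨ f , g ⟩ ∘ h) ≈⟨ ≈-sym assoc ⟩
           (π₁ ∘ ⟨ f , g ⟩) ∘ h ≈⟨ ∘-resp-≈ (Product.project₁ (product A B)) ≈-refl ⟩
           f ∘ h ∎)
    (begin π₂ ∘ (⟨ f , g ⟩ ∘ h) ≈⟨ ≈-sym assoc ⟩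
           (π₂ ∘ ⟨ f , g ⟩) ∘ h ≈⟨ ∘-resp-≈ (Product.project₂ (product A B)) ≈-refl ⟩
           g ∘ h ∎)
    where open HomReasoning
          open FinitelyComplete finLim

  ⟨⟩-cong : ∀ {Z A B} {f f' : Z ⇒ A} {g g' : Z ⇒ B} →
            f ≈ f' → g ≈ g' → ⟨ f , g ⟩ ≈ ⟨ f' , g' ⟩
  ⟨⟩-cong {A = A} {B} {f} {f'} {g} {g'} p q = Product.unique (product A B)
    (≈-trans (Product.project₁ (product A B)) p)
    (≈-trans (Product.project₂ (product A B)) q)
    where open FinitelyComplete finLim

  ⁂∘⟨⟩ : ∀ {Z A B C D} {f : A ⇒ B} {g : C ⇒ D} {h : Z ⇒ A} {k : Z ⇒ C} →
         (f ⁂ g) ∘ ⟨ h , k ⟩ ≈ ⟨ f ∘ h , g ∘ k ⟩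
  ⁂∘⟨⟩ {A = A} {B} {C} {D} {f} {g} {h} {k} = begin
    ⟨ f ∘ π₁ , g ∘ π₂ ⟩ ∘ ⟨ h , k ⟩           ≈⟨ ⟨⟩∘ ⟩
    ⟨ (f ∘ π₁) ∘ ⟨ h , k ⟩ , (g ∘ π₂) ∘ ⟨ h , k ⟩ ⟩
      ≈⟨ ⟨⟩-cong (≈-trans assoc (∘-resp-≈ ≈-refl (Product.project₁ (product A C))))
                 (≈-trans assoc (∘-resp-≈ ≈-refl (Product.project₂ (product A C)))) ⟩
    ⟨ f ∘ h , g ∘ k ⟩ ∎
    where open HomReasoning
          open FinitelyComplete finLim

  ⁂∘⁂ : ∀ {A B C D E F} {f : B ⇒ C} {g : E ⇒ F} {h : A ⇒ B} {k : D ⇒ E} →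
        (f ⁂ g) ∘ (h ⁂ k) ≈ (f ∘ h) ⁂ (g ∘ k)
  ⁂∘⁂ {f = f} {g} {h} {k} = begin
    (f ⁂ g) ∘ ⟨ h ∘ π₁ , k ∘ π₂ ⟩     ≈⟨ ⁂∘⟨⟩ ⟩
    ⟨ f ∘ (h ∘ π₁) , g ∘ (k ∘ π₂) ⟩   ≈⟨ ⟨⟩-cong (≈-sym assoc) (≈-sym assoc) ⟩
    (f ∘ h) ⁂ (g ∘ k) ∎
    where open HomReasoning

  ⁂-interchange : ∀ {A B I} (δ : ⊤ ⇒ I) (m : A ⇒ B) →
    (δ ⁂ id {B}) ∘ (id {⊤} ⁂ m) ≈ (id {I} ⁂ m) ∘ (δ ⁂ id {A})
  ⁂-interchange δ m = begin
    (δ ⁂ id) ∘ (id ⁂ m)   ≈⟨ ⁂∘⁂ ⟩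
    (δ ∘ id) ⁂ (id ∘ m)   ≈⟨ ⟨⟩-cong (∘-resp-≈ (≈-trans identityʳ (≈-sym identityˡ)) ≈-refl)
                                     (∘-resp-≈ (≈-trans identityˡ (≈-sym identityʳ)) ≈-refl) ⟩
    (id ∘ δ) ⁂ (m ∘ id)   ≈⟨ ≈-sym ⁂∘⁂ ⟩
    (id ⁂ m) ∘ (δ ⁂ id) ∎
    where open HomReasoning

  module PushoutProduct {A B I : Obj} (δ : ⊤ ⇒ I) (m : A ⇒ B) where
    po : Pushout (id {⊤} ⁂ m) (δ ⁂ id {A})
    po = pushout (id ⁂ m) (δ ⁂ id)

    dom : Obj
    dom = Pushout.Q po

    map : dom ⇒ I ×₀ B
    map = Pushout.copair po (⁂-interchange δ m)

  _×̂_ : ∀ {A B I : Obj} (δ : ⊤ ⇒ I) (m : A ⇒ B) →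
        PushoutProduct.dom δ m ⇒ I ×₀ B
  δ ×̂ m = PushoutProduct.map δ m

  module Relative {c : Level} (Cof : ∀ {A B} → A ⇒ B → Set c)
                  {𝕀 : Obj} (δ₀ δ₁ : ⊤ ⇒ 𝕀) where

    IsTrivialFibration : ∀ {X Y} → X ⇒ Y → Set (o ⊔ ℓ ⊔ e ⊔ c)
    IsTrivialFibration f = ∀ {A B} (m : A ⇒ B) → Cof m → HasRLP m f

    IsFibration : ∀ {X Y} → X ⇒ Y → Set (o ⊔ ℓ ⊔ e ⊔ c)
    IsFibration f = ∀ {A B} (m : A ⇒ B) → Cof m →
                    HasRLP (δ₀ ×̂ m) f × HasRLP (δ₁ ×̂ m) f

    f^𝕀 : ∀ {X Y} → X ⇒ Y → (𝕀 ⇨ X) ⇒ (𝕀 ⇨ Y)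
    f^𝕀 f = curry (f ∘ eval)

    r : ∀ Y → Y ⇒ (𝕀 ⇨ Y)
    r Y = curry π₁

    evAt : ∀ {Z X} → (⊤ ⇒ 𝕀) → Z ⇒ (𝕀 ⇨ X) → Z ⇒ X
    evAt δ γ = eval ∘ ⟨ γ , δ ∘ ! ⟩

    module PathObject {X Y : Obj} (f : X ⇒ Y) where
      pb : Pullback (f^𝕀 f) (r Y)
      pb = pullback (f^𝕀 f) (r Y)

      P : Obj
      P = Pullback.P pb

      p₀ : P ⇒ X
      p₀ = evAt δ₀ (Pullback.p₁ pb)

      p₁ : P ⇒ X
      p₁ = evAt δ₁ (Pullback.p₁ pb)

      f∘evAt : ∀ (δ : ⊤ ⇒ 𝕀) → f ∘ evAt δ (Pullback.p₁ pb) ≈ Pullback.p₂ pb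
      f∘evAt δ = begin
        f ∘ (eval ∘ ⟨ γ , d ⟩)                 ≈⟨ ≈-sym assoc ⟩
        (f ∘ eval) ∘ ⟨ γ , d ⟩                 ≈⟨ ∘-resp-≈ (≈-sym (Exponential.β (exponential 𝕀 Y))) ≈-refl ⟩
        (eval ∘ (f^𝕀 f ⁂ id)) ∘ ⟨ γ , d ⟩      ≈⟨ assoc ⟩
        eval ∘ ((f^𝕀 f ⁂ id) ∘ ⟨ γ , d ⟩)      ≈⟨ ∘-resp-≈ ≈-refl ⁂∘⟨⟩ ⟩
        eval ∘ ⟨ f^𝕀 f ∘ γ , id ∘ d ⟩          ≈⟨ ∘-resp-≈ ≈-refl (⟨⟩-cong (Pullback.commute pb) ≈-refl) ⟩
        eval ∘ ⟨ r Y ∘ y , id ∘ d ⟩            ≈⟨ ∘-resp-≈ ≈-refl (≈-sym ⁂∘⟨⟩) ⟩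
        eval ∘ ((r Y ⁂ id) ∘ ⟨ y , d ⟩)        ≈⟨ ≈-sym assoc ⟩
        (eval ∘ (r Y ⁂ id)) ∘ ⟨ y , d ⟩        ≈⟨ ∘-resp-≈ (Exponential.β (exponential 𝕀 Y)) ≈-refl ⟩
        π₁ ∘ ⟨ y , d ⟩                         ≈⟨ Product.project₁ (FinitelyComplete.product finLim Y 𝕀) ⟩
        y ∎
        where
          open HomReasoning
          γ = Pullback.p₁ pb
          y = Pullback.p₂ pb
          d = δ ∘ !

      p-commute : f ∘ p₀ ≈ f ∘ p₁
      p-commute = ≈-trans (f∘evAt δ₀) (≈-sym (f∘evAt δ₁))

      kp : Pullback f f
      kp = pullback f f

      ⟨p₀,p₁⟩ : P ⇒ Pullback.P kp
      ⟨p₀,p₁⟩ = Pullback.universal kp p-commute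

    IsHProposition : ∀ {X Y} → X ⇒ Y → Set (o ⊔ ℓ ⊔ e ⊔ c)
    IsHProposition f = IsFibration f × IsTrivialFibration (PathObject.⟨p₀,p₁⟩ f)

    HasSection : ∀ {X Y} → X ⇒ Y → Set (ℓ ⊔ e)
    HasSection {X} {Y} f = Σ[ s ∈ Y ⇒ X ] (f ∘ s ≈ id)

record CofibrationsAndInterval {o ℓ e : Level} {𝒞 : Category o ℓ e}
       (𝓛 : LCCCWithFiniteColimits 𝒞) (c : Level)
       : Set (o ⊔ ℓ ⊔ e ⊔ lsuc c) where
  open Category 𝒞
  open Universal 𝒞
  open Homotopy 𝓛
  field
    Cof : ∀ {A B} → A ⇒ B → Set c
    𝕀   : Obj
    δ₀  : ⊤ ⇒ 𝕀
    δ₁  : ⊤ ⇒ 𝕀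
    G1 : ∀ {A B B'} (m : A ⇒ B) (g : B' ⇒ B) → Cof m →
         Cof (Pullback.p₂ (pullback m g))
    -- (G2) cofibrations are closed under binary unions:
    --      for m : A ⇒ C, n : B ⇒ C, the map  A ∪ B = A ⊔_{A ×_C B} B ⇒ C
    G2 : ∀ {A B C} (m : A ⇒ C) (n : B ⇒ C) → Cof m → Cof n →
         Cof (Pushout.copair
                (pushout (Pullback.p₁ (pullback m n)) (Pullback.p₂ (pullback m n)))
                (Pullback.commute (pullback m n)))
    ∧ : 𝕀 ×₀ 𝕀 ⇒ 𝕀
    ∨ : 𝕀 ×₀ 𝕀 ⇒ 𝕀
    0∧i : ∧ ∘ ⟨ δ₀ ∘ ! , id ⟩ ≈ δ₀ ∘ !
    i∧0 : ∧ ∘ ⟨ id , δ₀ ∘ ! ⟩ ≈ δ₀ ∘ !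
    1∧i : ∧ ∘ ⟨ δ₁ ∘ ! , id ⟩ ≈ id
    i∧1 : ∧ ∘ ⟨ id , δ₁ ∘ ! ⟩ ≈ id
    0∨i : ∨ ∘ ⟨ δ₀ ∘ ! , id ⟩ ≈ id
    i∨0 : ∨ ∘ ⟨ id , δ₀ ∘ ! ⟩ ≈ id
    1∨i : ∨ ∘ ⟨ δ₁ ∘ ! , id ⟩ ≈ δ₁ ∘ !
    i∨1 : ∨ ∘ ⟨ id , δ₁ ∘ ! ⟩ ≈ δ₁ ∘ !
    G4 : IsInitial (Pullback.P (pullback δ₀ δ₁))
    G5₀ : Cof δ₀
    G5₁ : Cof δ₁
    G6 : ∀ {X Y} (f : X ⇒ Y) →
         Σ[ M ∈ Obj ] Σ[ i ∈ X ⇒ M ] Σ[ p ∈ M ⇒ Y ]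
           (Cof i × Homotopy.Relative.IsTrivialFibration 𝓛 Cof δ₀ δ₁ p × (p ∘ i ≈ f))
    G7 : ∀ {X} → Cof (¡ {X})

module Notions {o ℓ e c : Level} {𝒞 : Category o ℓ e}
               (𝓛 : LCCCWithFiniteColimits 𝒞)
               (𝓘 : CofibrationsAndInterval 𝓛 c) where
  open Category 𝒞 public
  open CofibrationsAndInterval 𝓘 public using (Cof; 𝕀; δ₀; δ₁)
  open Homotopy.Relative 𝓛 (CofibrationsAndInterval.Cof 𝓘)
         (CofibrationsAndInterval.δ₀ 𝓘) (CofibrationsAndInterval.δ₁ 𝓘) public

-- To solve a lifting problem (u , v) of f against a cofibration m, use the section s:
-- s ∘ v solves it up to the top map, since (s ∘ v) ∘ m and u lie in the same fibre of f.
-- As ⟨p₀,p₁⟩ is a trivial fibration, these two maps are joined by a homotopy that is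
-- vertical over f, and lifting against δ₀ ×̂ m transports s ∘ v along it to a map
-- that restricts to u on A and still lies over v.
module Submission where

open import Data.Product using (Σ-syntax; _×_; _,_; proj₁; proj₂)
open import Level using (_⊔_)
open import Defs

module FibrewiseHomotopies {o ℓ e} {𝒞 : Category o ℓ e}
                           (𝓛 : LCCCWithFiniteColimits 𝒞) where
  open Category 𝒞
  open Universal 𝒞
  open Homotopy 𝓛
  open LCCCWithFiniteColimits 𝓛 using (finLim; exponential)
  open HomReasoning

  infixr 4 _⟩∘⟨_
  _⟩∘⟨_ : ∀ {A B C} {f h : B ⇒ C} {g i : A ⇒ B} → f ≈ h → g ≈ i → f ∘ g ≈ h ∘ i
  _⟩∘⟨_ = ∘-resp-≈

  project₁ : ∀ {Z A B} {f : Z ⇒ A} {g : Z ⇒ B} → π₁ ∘ ⟨ f , g ⟩ ≈ f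
  project₁ {A = A} {B} = Product.project₁ (FinitelyComplete.product finLim A B)

  project₂ : ∀ {Z A B} {f : Z ⇒ A} {g : Z ⇒ B} → π₂ ∘ ⟨ f , g ⟩ ≈ g
  project₂ {A = A} {B} = Product.project₂ (FinitelyComplete.product finLim A B)

  !-unique₂ : ∀ {A} (f g : A ⇒ ⊤) → f ≈ g
  !-unique₂ f g = ≈-trans (!-unique f) (≈-sym (!-unique g))

  ¡-unique₂ : ∀ {A} (f g : ⊥ ⇒ A) → f ≈ g
  ¡-unique₂ f g = ≈-trans (Initial.¡-unique initial f) (≈-sym (Initial.¡-unique initial g))

  pullˡ : ∀ {A B C D} {f : C ⇒ D} {g : B ⇒ C} {h : B ⇒ D} {k : A ⇒ B} →
           f ∘ g ≈ h → f ∘ (g ∘ k) ≈ h ∘ k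
  pullˡ eq = ≈-trans (≈-sym assoc) (eq ⟩∘⟨ ≈-refl)

  pullʳ : ∀ {A B C D} {f : C ⇒ D} {g : B ⇒ C} {h : A ⇒ B} {k : A ⇒ C} →
          g ∘ h ≈ k → (f ∘ g) ∘ h ≈ f ∘ k
  pullʳ eq = ≈-trans assoc (≈-refl ⟩∘⟨ eq)

  pushout-jointly-epic : ∀ {A B C Z} {f : C ⇒ A} {g : C ⇒ B} (PO : Pushout f g)
                         {a b : Pushout.Q PO ⇒ Z} →
                         a ∘ Pushout.i₁ PO ≈ b ∘ Pushout.i₁ PO →
                         a ∘ Pushout.i₂ PO ≈ b ∘ Pushout.i₂ PO → a ≈ b
  pushout-jointly-epic PO p q =
    ≈-trans (Pushout.unique PO commute ≈-refl ≈-refl)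
            (≈-sym (Pushout.unique PO commute (≈-sym p) (≈-sym q)))
    where
      commute = ≈-trans assoc (≈-trans (≈-refl ⟩∘⟨ Pushout.commute PO) (≈-sym assoc))

  β-at : ∀ {Z W A B} {k : W ×₀ A ⇒ B} {a : Z ⇒ W} {b : Z ⇒ A} →
         eval ∘ ⟨ curry k ∘ a , b ⟩ ≈ k ∘ ⟨ a , b ⟩
  β-at {A = A} {B} {k} {a} {b} = begin
    eval ∘ ⟨ curry k ∘ a , b ⟩          ≈⟨ ≈-refl ⟩∘⟨ ⟨⟩-cong ≈-refl (≈-sym identityˡ) ⟩
    eval ∘ ⟨ curry k ∘ a , id ∘ b ⟩     ≈⟨ ≈-refl ⟩∘⟨ ≈-sym ⁂∘⟨⟩ ⟩
    eval ∘ ((curry k ⁂ id) ∘ ⟨ a , b ⟩) ≈⟨ pullˡ (Exponential.β (exponential A B)) ⟩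
    k ∘ ⟨ a , b ⟩                       ∎

  atEnd : ∀ {I A} → ⊤ ⇒ I → A ⇒ I ×₀ A
  atEnd δ = ⟨ δ ∘ ! , id ⟩

  π₂∘atEnd : ∀ {I A} (δ : ⊤ ⇒ I) → π₂ ∘ atEnd {A = A} δ ≈ id
  π₂∘atEnd δ = project₂

  atEnd-natural : ∀ {I A B} (δ : ⊤ ⇒ I) (m : A ⇒ B) →
                  atEnd δ ∘ m ≈ (id ⁂ m) ∘ atEnd δ
  atEnd-natural δ m = begin
    ⟨ δ ∘ ! , id ⟩ ∘ m        ≈⟨ ⟨⟩∘ ⟩
    ⟨ (δ ∘ !) ∘ m , id ∘ m ⟩  ≈⟨ ⟨⟩-cong (≈-trans assoc (≈-trans (≈-refl ⟩∘⟨ !-unique₂ _ _) (≈-sym identityˡ)))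
                                         (≈-trans identityˡ (≈-sym identityʳ)) ⟩
    ⟨ id ∘ (δ ∘ !) , m ∘ id ⟩ ≈⟨ ≈-sym ⁂∘⟨⟩ ⟩
    (id ⁂ m) ∘ ⟨ δ ∘ ! , id ⟩ ∎

  ⁂id≈atEnd∘π₂ : ∀ {I A} (δ : ⊤ ⇒ I) → δ ⁂ id {A} ≈ atEnd δ ∘ π₂
  ⁂id≈atEnd∘π₂ δ = begin
    ⟨ δ ∘ π₁ , id ∘ π₂ ⟩         ≈⟨ ⟨⟩-cong (≈-refl ⟩∘⟨ !-unique₂ _ _) ≈-refl ⟩
    ⟨ δ ∘ (! ∘ π₂) , id ∘ π₂ ⟩   ≈⟨ ⟨⟩-cong (≈-sym assoc) ≈-refl ⟩
    ⟨ (δ ∘ !) ∘ π₂ , id ∘ π₂ ⟩   ≈⟨ ≈-sym ⟨⟩∘ ⟩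
    ⟨ δ ∘ ! , id ⟩ ∘ π₂          ∎

  module _ {c} (Cof : ∀ {A B} → A ⇒ B → Set c) {𝕀 : Obj} (δ₀ δ₁ : ⊤ ⇒ 𝕀) where
    open Relative Cof δ₀ δ₁

    trivialFibration⇒lift : ∀ {A E K} {g : E ⇒ K} → IsTrivialFibration g →
                            Cof (¡ {A}) → (k : A ⇒ K) → Σ[ h ∈ A ⇒ E ] g ∘ h ≈ k
    trivialFibration⇒lift tf cof k with tf ¡ cof ¡ k (¡-unique₂ _ _)
    ... | h , _ , gh≈k = h , gh≈k

    evAt∘ : ∀ {Z W X} (δ : ⊤ ⇒ 𝕀) (γ : Z ⇒ (𝕀 ⇨ X)) (h : W ⇒ Z) →
            evAt δ γ ∘ h ≈ evAt δ (γ ∘ h)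
    evAt∘ δ γ h = ≈-trans assoc (≈-refl ⟩∘⟨ ≈-trans ⟨⟩∘
                    (⟨⟩-cong ≈-refl (≈-trans assoc (≈-refl ⟩∘⟨ !-unique₂ _ _))))

    homotopyOf : ∀ {A X} → A ⇒ (𝕀 ⇨ X) → 𝕀 ×₀ A ⇒ X
    homotopyOf γ = eval ∘ ⟨ γ ∘ π₂ , π₁ ⟩

    homotopyOf-cong : ∀ {A X} {γ γ' : A ⇒ (𝕀 ⇨ X)} → γ ≈ γ' → homotopyOf γ ≈ homotopyOf γ'
    homotopyOf-cong eq = ≈-refl ⟩∘⟨ ⟨⟩-cong (eq ⟩∘⟨ ≈-refl) ≈-refl

    homotopyOf-curry : ∀ {A W X} (k : W ×₀ 𝕀 ⇒ X) (γ : A ⇒ W) →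
                       homotopyOf (curry k ∘ γ) ≈ k ∘ ⟨ γ ∘ π₂ , π₁ ⟩
    homotopyOf-curry k γ = ≈-trans (≈-refl ⟩∘⟨ ⟨⟩-cong assoc ≈-refl) β-at

    homotopyOf∘atEnd : ∀ {A X} (γ : A ⇒ (𝕀 ⇨ X)) (δ : ⊤ ⇒ 𝕀) →
                       homotopyOf γ ∘ atEnd δ ≈ evAt δ γ
    homotopyOf∘atEnd γ δ = begin
      (eval ∘ ⟨ γ ∘ π₂ , π₁ ⟩) ∘ ⟨ δ ∘ ! , id ⟩                ≈⟨ assoc ⟩
      eval ∘ (⟨ γ ∘ π₂ , π₁ ⟩ ∘ ⟨ δ ∘ ! , id ⟩)                ≈⟨ ≈-refl ⟩∘⟨ ⟨⟩∘ ⟩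
      eval ∘ ⟨ (γ ∘ π₂) ∘ ⟨ δ ∘ ! , id ⟩ , π₁ ∘ ⟨ δ ∘ ! , id ⟩ ⟩
        ≈⟨ ≈-refl ⟩∘⟨ ⟨⟩-cong (≈-trans assoc (≈-trans (≈-refl ⟩∘⟨ project₂) identityʳ)) project₁ ⟩
      eval ∘ ⟨ γ , δ ∘ ! ⟩                                    ∎

    record FibrewiseHomotopy {A X Y} (f : X ⇒ Y) (a b : A ⇒ X) : Set (ℓ ⊔ e) where
      field
        homotopy : 𝕀 ×₀ A ⇒ X
        starts   : homotopy ∘ atEnd δ₀ ≈ a
        ends     : homotopy ∘ atEnd δ₁ ≈ b
        vertical : f ∘ homotopy ≈ (f ∘ a) ∘ π₂

    FibrewiseHomotopy-resp-≈ : ∀ {A X Y} {f : X ⇒ Y} {a a' b b' : A ⇒ X} →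
                               a ≈ a' → b ≈ b' →
                               FibrewiseHomotopy f a b → FibrewiseHomotopy f a' b'
    FibrewiseHomotopy-resp-≈ a≈a' b≈b' H = record
      { homotopy = homotopy
      ; starts   = ≈-trans starts a≈a'
      ; ends     = ≈-trans ends b≈b'
      ; vertical = ≈-trans vertical ((≈-refl ⟩∘⟨ a≈a') ⟩∘⟨ ≈-refl)
      }
      where open FibrewiseHomotopy H

    module _ {X Y : Obj} (f : X ⇒ Y) where
      open PathObject f

      pathHomotopy : ∀ {A} (h : A ⇒ P) → FibrewiseHomotopy f (p₀ ∘ h) (p₁ ∘ h)
      pathHomotopy h = record
        { homotopy = homotopyOf γ
        ; starts   = ≈-trans (homotopyOf∘atEnd γ δ₀) (≈-sym (evAt∘ δ₀ path h))
        ; ends     = ≈-trans (homotopyOf∘atEnd γ δ₁) (≈-sym (evAt∘ δ₁ path h))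
        ; vertical = begin
            f ∘ (eval ∘ ⟨ γ ∘ π₂ , π₁ ⟩)          ≈⟨ ≈-sym assoc ⟩
            (f ∘ eval) ∘ ⟨ γ ∘ π₂ , π₁ ⟩          ≈⟨ ≈-sym (homotopyOf-curry (f ∘ eval) γ) ⟩
            homotopyOf (f^𝕀 f ∘ (path ∘ h))       ≈⟨ homotopyOf-cong (≈-trans (pullˡ (Pullback.commute pb)) assoc) ⟩
            homotopyOf (r Y ∘ (base ∘ h))         ≈⟨ homotopyOf-curry π₁ (base ∘ h) ⟩
            π₁ ∘ ⟨ (base ∘ h) ∘ π₂ , π₁ ⟩         ≈⟨ project₁ ⟩
            (base ∘ h) ∘ π₂                       ≈⟨ ≈-sym (pullˡ (f∘evAt δ₀)) ⟩∘⟨ ≈-refl ⟩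
            (f ∘ (p₀ ∘ h)) ∘ π₂                   ∎
        }
        where
          path = Pullback.p₁ pb
          base = Pullback.p₂ pb
          γ = path ∘ h

      -- The pair (a , b) lifts through the trivial fibration ⟨p₀,p₁⟩ to a path.
      hProposition⇒fibrewiseHomotopic :
        ∀ {A} → IsTrivialFibration ⟨p₀,p₁⟩ → Cof (¡ {A}) →
        {a b : A ⇒ X} → f ∘ a ≈ f ∘ b → FibrewiseHomotopy f a b
      hProposition⇒fibrewiseHomotopic tf cof {a} {b} fa≈fb
        with trivialFibration⇒lift tf cof (Pullback.universal kp fa≈fb)
      ... | h , h-over = FibrewiseHomotopy-resp-≈
              (endpoint (Pullback.p₁∘universal kp p-commute) (Pullback.p₁∘universal kp fa≈fb))
              (endpoint (Pullback.p₂∘universal kp p-commute) (Pullback.p₂∘universal kp fa≈fb))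
              (pathHomotopy h)
        where
          endpoint : ∀ {q z} {g : Pullback.P kp ⇒ X} →
                     g ∘ ⟨p₀,p₁⟩ ≈ q → g ∘ Pullback.universal kp fa≈fb ≈ z → q ∘ h ≈ z
          endpoint g∘⟨p₀,p₁⟩≈q g∘pair≈z =
            ≈-trans (≈-sym g∘⟨p₀,p₁⟩≈q ⟩∘⟨ ≈-refl) (≈-trans (pullʳ h-over) g∘pair≈z)

    -- Fill the cylinder on m by lifting against δ₀ ×̂ m, then restrict it to the end δ₁.
    fibration⇒extend-along-fibrewiseHomotopy :
      ∀ {A B X Y} {f : X ⇒ Y} {m : A ⇒ B} → IsFibration f → Cof m →
      (w : B ⇒ X) {u : A ⇒ X} → FibrewiseHomotopy f (w ∘ m) u →
      Σ[ d ∈ B ⇒ X ] (d ∘ m ≈ u × f ∘ d ≈ f ∘ w)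
    fibration⇒extend-along-fibrewiseHomotopy {B = B} {X} {Y} {f} {m} isFib cof w {u} H =
      D ∘ atEnd δ₁ , d∘m≈u , f∘d≈f∘w
      where
        open FibrewiseHomotopy H
        open PushoutProduct δ₀ m using (po; map)
        open Pushout po using (i₁; i₂; copair; copair∘i₁; copair∘i₂)

        map∘i₁ : map ∘ i₁ ≈ δ₀ ⁂ id
        map∘i₁ = copair∘i₁ (⁂-interchange δ₀ m)

        map∘i₂ : map ∘ i₂ ≈ id ⁂ m
        map∘i₂ = copair∘i₂ (⁂-interchange δ₀ m)

        ends-agree : (w ∘ π₂) ∘ (id ⁂ m) ≈ homotopy ∘ (δ₀ ⁂ id)
        ends-agree = begin
          (w ∘ π₂) ∘ (id ⁂ m)        ≈⟨ pullʳ project₂ ⟩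
          w ∘ (m ∘ π₂)               ≈⟨ ≈-sym assoc ⟩
          (w ∘ m) ∘ π₂               ≈⟨ ≈-sym starts ⟩∘⟨ ≈-refl ⟩
          (homotopy ∘ atEnd δ₀) ∘ π₂ ≈⟨ pullʳ (≈-sym (⁂id≈atEnd∘π₂ δ₀)) ⟩
          homotopy ∘ (δ₀ ⁂ id)       ∎

        top : PushoutProduct.dom δ₀ m ⇒ X
        top = copair ends-agree

        bottom : 𝕀 ×₀ B ⇒ Y
        bottom = (f ∘ w) ∘ π₂

        square : f ∘ top ≈ bottom ∘ map
        square = pushout-jointly-epic po
          (begin
            (f ∘ top) ∘ i₁             ≈⟨ pullʳ (copair∘i₁ ends-agree) ⟩
            f ∘ (w ∘ π₂)               ≈⟨ ≈-sym assoc ⟩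
            (f ∘ w) ∘ π₂               ≈⟨ ≈-refl ⟩∘⟨ ≈-sym (≈-trans project₂ identityˡ) ⟩
            (f ∘ w) ∘ (π₂ ∘ (δ₀ ⁂ id)) ≈⟨ ≈-sym assoc ⟩
            bottom ∘ (δ₀ ⁂ id)         ≈⟨ ≈-sym (pullʳ map∘i₁) ⟩
            (bottom ∘ map) ∘ i₁        ∎)
          (begin
            (f ∘ top) ∘ i₂             ≈⟨ pullʳ (copair∘i₂ ends-agree) ⟩
            f ∘ homotopy               ≈⟨ vertical ⟩
            (f ∘ (w ∘ m)) ∘ π₂         ≈⟨ ≈-trans (≈-sym assoc ⟩∘⟨ ≈-refl) assoc ⟩
            (f ∘ w) ∘ (m ∘ π₂)         ≈⟨ ≈-refl ⟩∘⟨ ≈-sym project₂ ⟩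
            (f ∘ w) ∘ (π₂ ∘ (id ⁂ m))  ≈⟨ ≈-sym assoc ⟩
            bottom ∘ (id ⁂ m)          ≈⟨ ≈-sym (pullʳ map∘i₂) ⟩
            (bottom ∘ map) ∘ i₂        ∎)

        filler : Σ[ D ∈ 𝕀 ×₀ B ⇒ X ] (D ∘ map ≈ top × f ∘ D ≈ bottom)
        filler = proj₁ (isFib m cof) top bottom square

        D : 𝕀 ×₀ B ⇒ X
        D = proj₁ filler

        d∘m≈u : (D ∘ atEnd δ₁) ∘ m ≈ u
        d∘m≈u = begin
          (D ∘ atEnd δ₁) ∘ m          ≈⟨ pullʳ (atEnd-natural δ₁ m) ⟩
          D ∘ ((id ⁂ m) ∘ atEnd δ₁)   ≈⟨ ≈-refl ⟩∘⟨ ≈-sym map∘i₂ ⟩∘⟨ ≈-refl ⟩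
          D ∘ ((map ∘ i₂) ∘ atEnd δ₁) ≈⟨ ≈-refl ⟩∘⟨ assoc ⟩
          D ∘ (map ∘ (i₂ ∘ atEnd δ₁)) ≈⟨ pullˡ (proj₁ (proj₂ filler)) ⟩
          top ∘ (i₂ ∘ atEnd δ₁)       ≈⟨ pullˡ (copair∘i₂ ends-agree) ⟩
          homotopy ∘ atEnd δ₁         ≈⟨ ends ⟩
          u                           ∎

        f∘d≈f∘w : f ∘ (D ∘ atEnd δ₁) ≈ f ∘ w
        f∘d≈f∘w = begin
          f ∘ (D ∘ atEnd δ₁)        ≈⟨ pullˡ (proj₂ (proj₂ filler)) ⟩
          ((f ∘ w) ∘ π₂) ∘ atEnd δ₁ ≈⟨ pullʳ (π₂∘atEnd δ₁) ⟩
          (f ∘ w) ∘ id              ≈⟨ identityʳ ⟩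
          f ∘ w                     ∎

    hProposition×section⇒trivialFibration :
      (∀ {A} → Cof (¡ {A})) →
      ∀ {X Y} (f : X ⇒ Y) → IsHProposition f → HasSection f → IsTrivialFibration f
    hProposition×section⇒trivialFibration ¡-cof {X} {Y} f (isFib , pathsTF) (s , f∘s≈id)
                                          {A} {B} m cof u v f∘u≈v∘m =
      d , d∘m≈u , ≈-trans f∘d≈f∘s∘v (s-section v)
      where
        s-section : ∀ {Z} (g : Z ⇒ Y) → f ∘ (s ∘ g) ≈ g
        s-section g = ≈-trans (pullˡ f∘s≈id) identityˡ

        same-fibre : f ∘ ((s ∘ v) ∘ m) ≈ f ∘ u
        same-fibre = ≈-trans (≈-refl ⟩∘⟨ assoc) (≈-trans (s-section (v ∘ m)) (≈-sym f∘u≈v∘m))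

        extension : Σ[ d ∈ B ⇒ X ] (d ∘ m ≈ u × f ∘ d ≈ f ∘ (s ∘ v))
        extension = fibration⇒extend-along-fibrewiseHomotopy isFib cof (s ∘ v)
                      (hProposition⇒fibrewiseHomotopic f pathsTF ¡-cof same-fibre)

        d : B ⇒ X
        d = proj₁ extension

        d∘m≈u : d ∘ m ≈ u
        d∘m≈u = proj₁ (proj₂ extension)

        f∘d≈f∘s∘v : f ∘ d ≈ f ∘ (s ∘ v)
        f∘d≈f∘s∘v = proj₂ (proj₂ extension)

mainTheorem9 : ∀ {o ℓ e c} {𝒞 : Category o ℓ e}
                 (𝓛 : LCCCWithFiniteColimits 𝒞)
                 (𝓘 : CofibrationsAndInterval 𝓛 c) →
                 let open Notions 𝓛 𝓘 in
                 ∀ {X Y : Obj} (f : X ⇒ Y) →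
                 IsHProposition f → HasSection f → IsTrivialFibration f
mainTheorem9 𝓛 𝓘 = hProposition×section⇒trivialFibration Cof δ₀ δ₁ G7
  where
    open FibrewiseHomotopies 𝓛
    open CofibrationsAndInterval 𝓘
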